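{- Let $b\ge2$ and $p\ge1$ be integers. As an identity of rational functions of $z$, \[ \sum_{n=1}^{b^p-1}s_{b}(n)z^{n}=\frac{1-z^{b^{p}}}{1-z}\sum_{l=0}^{p-1}\frac{z^{b^{l}}-bz^{b^{l+1}}+(b-1)z^{(b+1)b^{l}}}{\left(1-z^{b^{l}}\right)\left(1-z^{b^{l+1}}\right)}. \] In particular, for $b=2$, \[ \sum_{n=1}^{2^p-1}s_{2}(n)z^{n}=\frac{1-z^{2^{p}}}{1-z}\sum_{l=0}^{p-1}\frac{z^{2^{l}}}{1+z^{2^{l}}}. \]
   Context: $s_b(n)$ is the sum of the base-$b$ digits of $n$. -}

module Defs where

open import Data.Nat as ℕ using (ℕ; zero; suc; NonZero)
open import Data.Nat.DivMod using (_/_; _%_)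
open import Data.Integer using (+_)
open import Data.Rational as ℚ using (ℚ; 0ℚ; 1ℚ; _+_; _*_; _÷_; ≢-nonZero)
open import Data.Rational.Properties using (_≟_)
open import Relation.Nullary using (yes; no)

-- Sum of the base-b digits of n (valid for b ≥ 2; the fuel n is enough
-- since n has at most n base-b digits when b ≥ 2).
digitSumAux : (b : ℕ) → .{{_ : NonZero b}} → ℕ → ℕ → ℕ
digitSumAux b zero    n = 0
digitSumAux b (suc f) n = (n % b) ℕ.+ digitSumAux b f (n / b)

s : (b : ℕ) → .{{_ : NonZero b}} → ℕ → ℕ
s b n = digitSumAux b n n

ℕ→ℚ : ℕ → ℚ
ℕ→ℚ n = (+ n) ℚ./ 1

infixr 8 _^ℚ_
_^ℚ_ : ℚ → ℕ → ℚ
q ^ℚ zero  = 1ℚ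
q ^ℚ suc n = q * (q ^ℚ n)

-- total division (only ever used where the denominator is assumed nonzero)
infixl 7 _÷'_
_÷'_ : ℚ → ℚ → ℚ
p ÷' q with q ≟ 0ℚ
... | yes _ = 0ℚ
... | no q≢0 = _÷_ p q {{≢-nonZero q≢0}}

-- Σ_{i = m}^{m + k - 1} f i   written  sumFrom m k f
sumFrom : ℕ → ℕ → (ℕ → ℚ) → ℚ
sumFrom m zero    f = 0ℚ
sumFrom m (suc k) f = f m + sumFrom (suc m) k f

module Submission where

-- Write G_k(z) = Σ_{n<k} z^n, W_b(z) = Σ_{d<b} d z^d and
-- P_p(z) = Σ_{n<b^p} s_b(n) z^n.  Splitting n < b^{p+1} as n = m b + d with
-- m < b^p, d < b, and using s_b(m b + d) = d + s_b(m), gives the recursion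
--     P_{p+1}(z) = G_{b^p}(z^b) W_b(z) + P_p(z^b) G_b(z).
-- The identity (1-z)^2 W_b(z) = z - b z^b + (b-1) z^{b+1} together with
-- G_b(z) (1-z) = 1 - z^b shows W_b(z) = G_b(z) T_b(z), where T_b is the
-- summand of the theorem; since G_{b^{p+1}}(z) = G_{b^p}(z^b) G_b(z), induction
-- on p yields P_p(z) = G_{b^p}(z) Σ_{l<p} T_b(z^{b^l}).  The theorem follows by
-- dropping the vanishing n = 0 term and writing G_{b^p}(z) = (1-z^{b^p})/(1-z).
-- For b = 2 the summand T_2(w) simplifies to w/(1+w).

open import Defs
open import Data.Nat as ℕ using (ℕ; suc; _^_; _≤_; _<_; NonZero)
open import Data.Rational using (ℚ; 0ℚ; 1ℚ; _+_; _-_; _*_)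
open import Data.Product using (_×_)
open import Relation.Binary.PropositionalEquality using (_≡_; _≢_)

open import Data.Nat using (zero; z≤n; s≤s)
import Data.Nat.Properties as ℕP
open import Data.Nat.DivMod using (_/_; _%_)
import Data.Nat.DivMod as ℕD
open import Data.Nat.Divisibility using (divides-refl)
import Data.Integer as ℤ
import Data.Integer.Properties as ℤP
import Data.Rational as ℚ
import Data.Rational.Properties as ℚP
open import Data.Nat.Coprimality using (1-coprimeTo) renaming (sym to coprime-sym)
open import Relation.Binary.PropositionalEquality
  using (refl; sym; trans; cong; cong₂; subst; module ≡-Reasoning)
open import Data.Product using (_,_)
open import Data.Empty using (⊥-elim)
open import Relation.Nullary using (yes; no)
open import Data.Rational.Solver using (module +-*-Solver)
open +-*-Solver

ℕ→ℚ-mkℚ : ∀ n → ℕ→ℚ n ≡ ℚ.mkℚ (ℤ.+ n) 0 (coprime-sym (1-coprimeTo n))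
ℕ→ℚ-mkℚ n = ℚP.normalize-coprime (coprime-sym (1-coprimeTo n))

ℕ→ℚ-+ : ∀ m n → ℕ→ℚ (m ℕ.+ n) ≡ ℕ→ℚ m + ℕ→ℚ n
ℕ→ℚ-+ m n rewrite ℕ→ℚ-mkℚ m | ℕ→ℚ-mkℚ n =
  cong (ℚ._/ 1) (sym (cong₂ ℤ._+_ (ℤP.*-identityʳ (ℤ.+ m)) (ℤP.*-identityʳ (ℤ.+ n))))

ℕ→ℚ-suc : ∀ n → ℕ→ℚ (suc n) ≡ 1ℚ + ℕ→ℚ n
ℕ→ℚ-suc = ℕ→ℚ-+ 1

sumFrom-cong-on : ∀ m k {f g : ℕ → ℚ} → (∀ i → i < m ℕ.+ k → f i ≡ g i)
                → sumFrom m k f ≡ sumFrom m k g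
sumFrom-cong-on m zero    eq = refl
sumFrom-cong-on m (suc k) eq =
  cong₂ _+_ (eq m (ℕP.m<m+n m (s≤s z≤n)))
            (sumFrom-cong-on (suc m) k (λ i i< → eq i (subst (i <_) (sym (ℕP.+-suc m k)) i<)))

sumFrom-cong : ∀ m k {f g : ℕ → ℚ} → (∀ i → f i ≡ g i) → sumFrom m k f ≡ sumFrom m k g
sumFrom-cong m k eq = sumFrom-cong-on m k (λ i _ → eq i)

sumFrom-shift : ∀ m k (f : ℕ → ℚ) → sumFrom (suc m) k f ≡ sumFrom m k (λ i → f (suc i))
sumFrom-shift m zero    f = refl
sumFrom-shift m (suc k) f = cong (f (suc m) +_) (sumFrom-shift (suc m) k f)

sumFrom-reindex : ∀ m k (f : ℕ → ℚ) → sumFrom m k f ≡ sumFrom 0 k (λ i → f (m ℕ.+ i))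
sumFrom-reindex zero    k f = refl
sumFrom-reindex (suc m) k f = trans (sumFrom-shift m k f) (sumFrom-reindex m k (λ i → f (suc i)))

sumFrom-split : ∀ m k j (f : ℕ → ℚ)
              → sumFrom m (k ℕ.+ j) f ≡ sumFrom m k f + sumFrom (m ℕ.+ k) j f
sumFrom-split m zero    j f rewrite ℕP.+-identityʳ m = sym (ℚP.+-identityˡ _)
sumFrom-split m (suc k) j f =
  trans (cong (f m +_) (sumFrom-split (suc m) k j f))
  (trans (sym (ℚP.+-assoc (f m) _ _))
         (cong (λ t → (f m + sumFrom (suc m) k f) + sumFrom t j f) (sym (ℕP.+-suc m k))))

sumFrom-snoc : ∀ m k (f : ℕ → ℚ) → sumFrom m (suc k) f ≡ sumFrom m k f + f (m ℕ.+ k)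
sumFrom-snoc m k f =
  trans (cong (λ t → sumFrom m t f) (ℕP.+-comm 1 k))
  (trans (sumFrom-split m k 1 f) (cong (sumFrom m k f +_) (ℚP.+-identityʳ (f (m ℕ.+ k)))))

sumFrom-+ : ∀ m k (f g : ℕ → ℚ)
          → sumFrom m k (λ i → f i + g i) ≡ sumFrom m k f + sumFrom m k g
sumFrom-+ m zero    f g = refl
sumFrom-+ m (suc k) f g =
  trans (cong (f m + g m +_) (sumFrom-+ (suc m) k f g))
  (solve 4 (λ a b s t → (a :+ b) :+ (s :+ t) := (a :+ s) :+ (b :+ t)) refl (f m) (g m) _ _)

sumFrom-*ˡ : ∀ m k c (f : ℕ → ℚ) → sumFrom m k (λ i → c * f i) ≡ c * sumFrom m k f
sumFrom-*ˡ m zero    c f = sym (ℚP.*-zeroʳ c)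
sumFrom-*ˡ m (suc k) c f =
  trans (cong (c * f m +_) (sumFrom-*ˡ (suc m) k c f)) (sym (ℚP.*-distribˡ-+ c (f m) _))

sumFrom-*ʳ : ∀ m k c (f : ℕ → ℚ) → sumFrom m k (λ i → f i * c) ≡ sumFrom m k f * c
sumFrom-*ʳ m k c f =
  trans (sumFrom-cong m k (λ i → ℚP.*-comm (f i) c)) (trans (sumFrom-*ˡ m k c f) (ℚP.*-comm c _))

sumFrom-blocks : ∀ N b (f : ℕ → ℚ)
  → sumFrom 0 (N ℕ.* b) f ≡ sumFrom 0 N (λ m → sumFrom 0 b (λ d → f (m ℕ.* b ℕ.+ d)))
sumFrom-blocks zero    b f = refl
sumFrom-blocks (suc N) b f = begin
  sumFrom 0 (b ℕ.+ N ℕ.* b) f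
    ≡⟨ cong (λ t → sumFrom 0 t f) (ℕP.+-comm b (N ℕ.* b)) ⟩
  sumFrom 0 (N ℕ.* b ℕ.+ b) f
    ≡⟨ sumFrom-split 0 (N ℕ.* b) b f ⟩
  sumFrom 0 (N ℕ.* b) f + sumFrom (N ℕ.* b) b f
    ≡⟨ cong₂ _+_ (sumFrom-blocks N b f) (sumFrom-reindex (N ℕ.* b) b f) ⟩
  sumFrom 0 N block + block N
    ≡⟨ sym (sumFrom-snoc 0 N block) ⟩
  sumFrom 0 (suc N) block ∎
  where
  open ≡-Reasoning
  block : ℕ → ℚ
  block m = sumFrom 0 b (λ d → f (m ℕ.* b ℕ.+ d))

^ℚ-+ : ∀ z a c → z ^ℚ (a ℕ.+ c) ≡ z ^ℚ a * z ^ℚ c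
^ℚ-+ z zero    c = sym (ℚP.*-identityˡ _)
^ℚ-+ z (suc a) c = trans (cong (z *_) (^ℚ-+ z a c)) (sym (ℚP.*-assoc z _ _))

^ℚ-* : ∀ z a c → z ^ℚ (a ℕ.* c) ≡ (z ^ℚ a) ^ℚ c
^ℚ-* z a zero    rewrite ℕP.*-zeroʳ a = refl
^ℚ-* z a (suc c) rewrite ℕP.*-suc a c =
  trans (^ℚ-+ z a (a ℕ.* c)) (cong (z ^ℚ a *_) (^ℚ-* z a c))

^ℚ-1 : ∀ z → z ^ℚ 1 ≡ z
^ℚ-1 = ℚP.*-identityʳ

*-cancelʳ : ∀ c x y → c ≢ 0ℚ → x * c ≡ y * c → x ≡ y
*-cancelʳ c x y c≢0 eq = begin
  x                   ≡⟨ sym (ℚP.*-identityʳ x) ⟩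
  x * 1ℚ              ≡⟨ cong (x *_) (sym (ℚP.*-inverseʳ c)) ⟩
  x * (c * ℚ.1/ c)    ≡⟨ sym (ℚP.*-assoc x c (ℚ.1/ c)) ⟩
  (x * c) * ℚ.1/ c    ≡⟨ cong (_* ℚ.1/ c) eq ⟩
  (y * c) * ℚ.1/ c    ≡⟨ ℚP.*-assoc y c (ℚ.1/ c) ⟩
  y * (c * ℚ.1/ c)    ≡⟨ cong (y *_) (ℚP.*-inverseʳ c) ⟩
  y * 1ℚ              ≡⟨ ℚP.*-identityʳ y ⟩
  y ∎
  where
  open ≡-Reasoning
  instance
    c-nonZero : ℚ.NonZero c
    c-nonZero = ℚ.≢-nonZero c≢0

*-≢0 : ∀ x y → x ≢ 0ℚ → y ≢ 0ℚ → x * y ≢ 0ℚ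
*-≢0 x y x≢0 y≢0 xy≡0 =
  x≢0 (*-cancelʳ y x 0ℚ y≢0 (trans xy≡0 (sym (ℚP.*-zeroˡ y))))

÷'-*-cancel : ∀ x y → y ≢ 0ℚ → (x ÷' y) * y ≡ x
÷'-*-cancel x y y≢0 with y ℚP.≟ 0ℚ
... | yes y≡0  = ⊥-elim (y≢0 y≡0)
... | no  y≢0′ =
  trans (ℚP.*-assoc x _ y)
  (trans (cong (x *_) (ℚP.*-inverseˡ y {{ℚ.≢-nonZero y≢0′}})) (ℚP.*-identityʳ x))

÷'-unique : ∀ x y q → y ≢ 0ℚ → q * y ≡ x → x ÷' y ≡ q
÷'-unique x y q y≢0 qy≡x = *-cancelʳ y _ q y≢0 (trans (÷'-*-cancel x y y≢0) (sym qy≡x))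

÷'-cross : ∀ x y x′ y′ → y ≢ 0ℚ → y′ ≢ 0ℚ → x * y′ ≡ x′ * y → x ÷' y ≡ x′ ÷' y′
÷'-cross x y x′ y′ y≢0 y′≢0 cross = ÷'-unique x y _ y≢0 (*-cancelʳ y′ _ x y′≢0 (begin
  (x′ ÷' y′) * y * y′   ≡⟨ solve 3 (λ q a c → (q :* a) :* c := (q :* c) :* a) refl (x′ ÷' y′) y y′ ⟩
  (x′ ÷' y′) * y′ * y   ≡⟨ cong (_* y) (÷'-*-cancel x′ y′ y′≢0) ⟩
  x′ * y                ≡⟨ sym cross ⟩
  x * y′ ∎))
  where open ≡-Reasoning

geom : ℕ → ℚ → ℚ
geom k z = sumFrom 0 k (z ^ℚ_)

geom-closed : ∀ k z → geom k z * (1ℚ - z) ≡ 1ℚ - z ^ℚ k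
geom-closed zero    z = ℚP.*-zeroˡ (1ℚ - z)
geom-closed (suc k) z = begin
  geom (suc k) z * (1ℚ - z)
    ≡⟨ cong (_* (1ℚ - z)) (sumFrom-snoc 0 k (z ^ℚ_)) ⟩
  (geom k z + z ^ℚ k) * (1ℚ - z)
    ≡⟨ ℚP.*-distribʳ-+ (1ℚ - z) (geom k z) (z ^ℚ k) ⟩
  geom k z * (1ℚ - z) + z ^ℚ k * (1ℚ - z)
    ≡⟨ cong (_+ z ^ℚ k * (1ℚ - z)) (geom-closed k z) ⟩
  (1ℚ - z ^ℚ k) + z ^ℚ k * (1ℚ - z)
    ≡⟨ solve 2 (λ z w → (con 1ℚ :- w) :+ w :* (con 1ℚ :- z) := con 1ℚ :- z :* w) refl z (z ^ℚ k) ⟩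
  1ℚ - z ^ℚ suc k ∎
  where open ≡-Reasoning

^ℚ-digits : ∀ z b m d → z ^ℚ (m ℕ.* b ℕ.+ d) ≡ (z ^ℚ b) ^ℚ m * z ^ℚ d
^ℚ-digits z b m d =
  trans (^ℚ-+ z (m ℕ.* b) d)
        (cong (_* z ^ℚ d) (trans (cong (z ^ℚ_) (ℕP.*-comm m b)) (^ℚ-* z b m)))

geom-blocks : ∀ N b z → geom (N ℕ.* b) z ≡ geom N (z ^ℚ b) * geom b z
geom-blocks N b z =
  trans (sumFrom-blocks N b (z ^ℚ_))
  (trans (sumFrom-cong 0 N (λ m →
            trans (sumFrom-cong 0 b (^ℚ-digits z b m))
                  (sumFrom-*ˡ 0 b ((z ^ℚ b) ^ℚ m) (z ^ℚ_))))
         (sumFrom-*ʳ 0 N (geom b z) ((z ^ℚ b) ^ℚ_)))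

weighted : ℕ → ℚ → ℚ
weighted b z = sumFrom 0 b (λ d → ℕ→ℚ d * z ^ℚ d)

-- The ring identity behind one induction step of weighted-numerator,
-- with w = z^c and C = c.
weighted-numerator-step : ∀ z w W C {C₁ C₂} → C₁ ≡ 1ℚ + C → C₂ ≡ 1ℚ + C₁
  → (1ℚ - z) * (1ℚ - z) * W ≡ (z - C₁ * (z * w)) + C * (z * (z * w))
  → (1ℚ - z) * (1ℚ - z) * (W + C₁ * (z * w))
    ≡ (z - C₂ * (z * (z * w))) + C₁ * (z * (z * (z * w)))
weighted-numerator-step z w W C refl refl ih =
  trans (ℚP.*-distribˡ-+ ((1ℚ - z) * (1ℚ - z)) W _)
  (trans (cong (_+ (1ℚ - z) * (1ℚ - z) * ((1ℚ + C) * (z * w))) ih)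
  (solve 3 (λ z w C →
       ((z :- (con 1ℚ :+ C) :* (z :* w)) :+ C :* (z :* (z :* w)))
         :+ (con 1ℚ :- z) :* (con 1ℚ :- z) :* ((con 1ℚ :+ C) :* (z :* w))
    := (z :- (con 1ℚ :+ (con 1ℚ :+ C)) :* (z :* (z :* w)))
         :+ (con 1ℚ :+ C) :* (z :* (z :* (z :* w)))) refl z w C))

weighted-numerator : ∀ c z → (1ℚ - z) * (1ℚ - z) * weighted (suc c) z
  ≡ (z - ℕ→ℚ (suc c) * z ^ℚ suc c) + ℕ→ℚ c * z ^ℚ suc (suc c)
weighted-numerator zero z =
  solve 1 (λ z → (con 1ℚ :- z) :* (con 1ℚ :- z) :* (con 0ℚ :* con 1ℚ :+ con 0ℚ)
             := (z :- con 1ℚ :* (z :* con 1ℚ)) :+ con 0ℚ :* (z :* (z :* con 1ℚ))) refl z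
weighted-numerator (suc c) z =
  trans (cong ((1ℚ - z) * (1ℚ - z) *_) (sumFrom-snoc 0 (suc c) (λ d → ℕ→ℚ d * z ^ℚ d)))
        (weighted-numerator-step z (z ^ℚ c) (weighted (suc c) z) (ℕ→ℚ c)
           (ℕ→ℚ-suc c) (ℕ→ℚ-suc (suc c)) (weighted-numerator c z))

levelTerm : ℕ → ℚ → ℚ
levelTerm b w =
  ((w - ℕ→ℚ b * w ^ℚ b) + ℕ→ℚ (b ℕ.∸ 1) * w ^ℚ (b ℕ.+ 1)) ÷' ((1ℚ - w) * (1ℚ - w ^ℚ b))

weighted-factor : ∀ b → 1 ≤ b → ∀ z → 1ℚ - z ≢ 0ℚ → 1ℚ - z ^ℚ b ≢ 0ℚ
                → weighted b z ≡ geom b z * levelTerm b z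
weighted-factor b@(suc c) _ z 1-z≢0 1-zᵇ≢0 = *-cancelʳ ((1ℚ - z) * (1ℚ - z)) _ _
  (*-≢0 _ _ 1-z≢0 1-z≢0) (begin
    weighted b z * ((1ℚ - z) * (1ℚ - z))
      ≡⟨ ℚP.*-comm (weighted b z) _ ⟩
    (1ℚ - z) * (1ℚ - z) * weighted b z
      ≡⟨ weighted-numerator c z ⟩
    (z - ℕ→ℚ b * z ^ℚ b) + ℕ→ℚ c * z ^ℚ suc b
      ≡⟨ cong (λ e → (z - ℕ→ℚ b * z ^ℚ b) + ℕ→ℚ c * z ^ℚ e) (ℕP.+-comm 1 b) ⟩
    numerator
      ≡⟨ sym (÷'-*-cancel numerator _ (*-≢0 _ _ 1-z≢0 1-zᵇ≢0)) ⟩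
    T * ((1ℚ - z) * (1ℚ - z ^ℚ b))
      ≡⟨ cong (λ v → T * ((1ℚ - z) * v)) (sym (geom-closed b z)) ⟩
    T * ((1ℚ - z) * (geom b z * (1ℚ - z)))
      ≡⟨ solve 3 (λ u g t → t :* (u :* (g :* u)) := g :* t :* (u :* u)) refl (1ℚ - z) (geom b z) T ⟩
    geom b z * T * ((1ℚ - z) * (1ℚ - z)) ∎)
  where
  open ≡-Reasoning
  numerator : ℚ
  numerator = (z - ℕ→ℚ b * z ^ℚ b) + ℕ→ℚ c * z ^ℚ (b ℕ.+ 1)
  T : ℚ
  T = levelTerm b z

-- The digit sum satisfies s_b(n) = (n mod b) + s_b(⌊n/b⌋) for b ≥ 2; the fuel
-- in the definition of s is irrelevant once it is at least n.
module DigitSum (b : ℕ) .{{_ : NonZero b}} (2≤b : 2 ≤ b) where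

  0%b≡0 : 0 % b ≡ 0
  0%b≡0 = ℕD.m<n⇒m%n≡m (ℕ.>-nonZero⁻¹ b)

  0/b≡0 : 0 / b ≡ 0
  0/b≡0 = ℕD.0/n≡0 b

  digitSumAux-zero : ∀ fuel → digitSumAux b fuel 0 ≡ 0
  digitSumAux-zero zero       = refl
  digitSumAux-zero (suc fuel)
    rewrite 0%b≡0 | 0/b≡0 = digitSumAux-zero fuel

  -- Division by b ≥ 2 makes positive numbers strictly smaller.
  /-shrinks : ∀ n fuel → n ≤ suc fuel → n / b ≤ fuel
  /-shrinks zero    fuel _    rewrite 0/b≡0 = z≤n
  /-shrinks (suc n) fuel n≤ = ℕP.≤-pred (ℕP.<-≤-trans (ℕD.m/n<m (suc n) b 2≤b) n≤)

  digitSumAux-fuel : ∀ f g n → n ≤ f → n ≤ g → digitSumAux b f n ≡ digitSumAux b g n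
  digitSumAux-fuel zero    g       zero    _   _   = sym (digitSumAux-zero g)
  digitSumAux-fuel (suc f) zero    zero    _   _   = digitSumAux-zero (suc f)
  digitSumAux-fuel (suc f) (suc g) n       n≤f n≤g =
    cong (n % b ℕ.+_) (digitSumAux-fuel f g (n / b) (/-shrinks n f n≤f) (/-shrinks n g n≤g))

  s-step : ∀ n → s b n ≡ n % b ℕ.+ s b (n / b)
  s-step zero rewrite 0%b≡0 | 0/b≡0 = refl
  s-step (suc n) =
    cong (suc n % b ℕ.+_)
         (digitSumAux-fuel n (suc n / b) (suc n / b) (/-shrinks (suc n) n ℕP.≤-refl) ℕP.≤-refl)

  s-digit : ∀ m d → d < b → s b (m ℕ.* b ℕ.+ d) ≡ d ℕ.+ s b m
  s-digit m d d<b = trans (s-step (m ℕ.* b ℕ.+ d)) (cong₂ (λ u v → u ℕ.+ s b v) last-digit rest)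
    where
    last-digit : (m ℕ.* b ℕ.+ d) % b ≡ d
    last-digit = trans (cong (_% b) (ℕP.+-comm (m ℕ.* b) d))
                       (trans (ℕD.[m+kn]%n≡m%n d m b) (ℕD.m<n⇒m%n≡m d<b))
    rest : (m ℕ.* b ℕ.+ d) / b ≡ m
    rest = trans (ℕD.+-distrib-/-∣ˡ d (divides-refl m))
                 (trans (cong₂ ℕ._+_ (ℕD.m*n/n≡m m b) (ℕD.m<n⇒m/n≡0 d<b)) (ℕP.+-identityʳ m))

levelSum : ℕ → ℕ → ℚ → ℚ
levelSum b p z = sumFrom 0 p (λ l → levelTerm b (z ^ℚ (b ^ l)))

levelSum-rec : ∀ b p z → levelSum b (suc p) z ≡ levelTerm b z + levelSum b p (z ^ℚ b)
levelSum-rec b p z =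
  cong₂ _+_ (cong (levelTerm b) (^ℚ-1 z))
  (trans (sumFrom-shift 0 p (λ l → levelTerm b (z ^ℚ (b ^ l))))
         (sumFrom-cong 0 p (λ l → cong (levelTerm b) (^ℚ-* z b (b ^ l)))))

geom-rec : ∀ b p z → geom (b ^ suc p) z ≡ geom (b ^ p) (z ^ℚ b) * geom b z
geom-rec b p z = trans (cong (λ k → geom k z) (ℕP.*-comm b (b ^ p))) (geom-blocks (b ^ p) b z)

module GeneratingFunction (b : ℕ) .{{_ : NonZero b}} (2≤b : 2 ≤ b) where

  open DigitSum b 2≤b using (s-digit)

  digitSumGF : ℕ → ℚ → ℚ
  digitSumGF p z = sumFrom 0 (b ^ p) (λ n → ℕ→ℚ (s b n) * z ^ℚ n)

  digit-block : ∀ z m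
    → sumFrom 0 b (λ d → ℕ→ℚ (s b (m ℕ.* b ℕ.+ d)) * z ^ℚ (m ℕ.* b ℕ.+ d))
      ≡ (z ^ℚ b) ^ℚ m * weighted b z + (ℕ→ℚ (s b m) * (z ^ℚ b) ^ℚ m) * geom b z
  digit-block z m =
    trans (sumFrom-cong-on 0 b term)
    (trans (sumFrom-+ 0 b (λ d → w * (ℕ→ℚ d * z ^ℚ d)) (λ d → (ℕ→ℚ (s b m) * w) * z ^ℚ d))
           (cong₂ _+_ (sumFrom-*ˡ 0 b w (λ d → ℕ→ℚ d * z ^ℚ d))
                      (sumFrom-*ˡ 0 b (ℕ→ℚ (s b m) * w) (z ^ℚ_))))
    where
    w : ℚ
    w = (z ^ℚ b) ^ℚ m
    term : ∀ d → d < b → ℕ→ℚ (s b (m ℕ.* b ℕ.+ d)) * z ^ℚ (m ℕ.* b ℕ.+ d)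
                         ≡ w * (ℕ→ℚ d * z ^ℚ d) + (ℕ→ℚ (s b m) * w) * z ^ℚ d
    term d d<b rewrite s-digit m d d<b | ℕ→ℚ-+ d (s b m) | ^ℚ-digits z b m d =
      solve 4 (λ e t w y → (e :+ t) :* (w :* y) := w :* (e :* y) :+ (t :* w) :* y) refl
        (ℕ→ℚ d) (ℕ→ℚ (s b m)) w (z ^ℚ d)

  digitSumGF-rec : ∀ p z → digitSumGF (suc p) z
    ≡ geom (b ^ p) (z ^ℚ b) * weighted b z + digitSumGF p (z ^ℚ b) * geom b z
  digitSumGF-rec p z = begin
    sumFrom 0 (b ℕ.* b ^ p) F
      ≡⟨ cong (λ k → sumFrom 0 k F) (ℕP.*-comm b (b ^ p)) ⟩
    sumFrom 0 (b ^ p ℕ.* b) F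
      ≡⟨ sumFrom-blocks (b ^ p) b F ⟩
    sumFrom 0 (b ^ p) (λ m → sumFrom 0 b (λ d → F (m ℕ.* b ℕ.+ d)))
      ≡⟨ sumFrom-cong 0 (b ^ p) (digit-block z) ⟩
    sumFrom 0 (b ^ p) (λ m → (z ^ℚ b) ^ℚ m * weighted b z + (ℕ→ℚ (s b m) * (z ^ℚ b) ^ℚ m) * geom b z)
      ≡⟨ sumFrom-+ 0 (b ^ p) _ _ ⟩
    sumFrom 0 (b ^ p) (λ m → (z ^ℚ b) ^ℚ m * weighted b z)
      + sumFrom 0 (b ^ p) (λ m → (ℕ→ℚ (s b m) * (z ^ℚ b) ^ℚ m) * geom b z)
      ≡⟨ cong₂ _+_ (sumFrom-*ʳ 0 (b ^ p) (weighted b z) ((z ^ℚ b) ^ℚ_))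
                   (sumFrom-*ʳ 0 (b ^ p) (geom b z) (λ m → ℕ→ℚ (s b m) * (z ^ℚ b) ^ℚ m)) ⟩
    geom (b ^ p) (z ^ℚ b) * weighted b z + digitSumGF p (z ^ℚ b) * geom b z ∎
    where
    open ≡-Reasoning
    F : ℕ → ℚ
    F n = ℕ→ℚ (s b n) * z ^ℚ n

  digitSumGF-closed : ∀ p z → (∀ l → l ≤ p → 1ℚ - z ^ℚ (b ^ l) ≢ 0ℚ)
                    → digitSumGF p z ≡ geom (b ^ p) z * levelSum b p z
  digitSumGF-closed zero    z _      = sym (ℚP.*-zeroʳ (geom 1 z))
  digitSumGF-closed (suc p) z nonzero = begin
    digitSumGF (suc p) z
      ≡⟨ digitSumGF-rec p z ⟩
    G′ * weighted b z + digitSumGF p (z ^ℚ b) * geom b z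
      ≡⟨ cong₂ (λ u v → G′ * u + v * geom b z)
               (weighted-factor b (ℕP.<⇒≤ 2≤b) z 1-z≢0 1-zᵇ≢0)
               (digitSumGF-closed p (z ^ℚ b) nonzero′) ⟩
    G′ * (geom b z * levelTerm b z) + (G′ * levelSum b p (z ^ℚ b)) * geom b z
      ≡⟨ solve 4 (λ g′ g t s′ → g′ :* (g :* t) :+ (g′ :* s′) :* g := (g′ :* g) :* (t :+ s′)) refl
           G′ (geom b z) (levelTerm b z) (levelSum b p (z ^ℚ b)) ⟩
    (G′ * geom b z) * (levelTerm b z + levelSum b p (z ^ℚ b))
      ≡⟨ sym (cong₂ _*_ (geom-rec b p z) (levelSum-rec b p z)) ⟩
    geom (b ^ suc p) z * levelSum b (suc p) z ∎
    where
    open ≡-Reasoning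
    G′ : ℚ
    G′ = geom (b ^ p) (z ^ℚ b)
    1-z≢0 : 1ℚ - z ≢ 0ℚ
    1-z≢0 = subst (λ w → 1ℚ - w ≢ 0ℚ) (^ℚ-1 z) (nonzero 0 z≤n)
    1-zᵇ≢0 : 1ℚ - z ^ℚ b ≢ 0ℚ
    1-zᵇ≢0 = subst (λ e → 1ℚ - z ^ℚ e ≢ 0ℚ) (ℕP.*-identityʳ b) (nonzero 1 (s≤s z≤n))
    nonzero′ : ∀ l → l ≤ p → 1ℚ - (z ^ℚ b) ^ℚ (b ^ l) ≢ 0ℚ
    nonzero′ l l≤p = subst (λ w → 1ℚ - w ≢ 0ℚ) (^ℚ-* z b (b ^ l)) (nonzero (suc l) (s≤s l≤p))

sumFrom-drop-zero : ∀ N → 0 < N → (f : ℕ → ℚ) → f 0 ≡ 0ℚ → sumFrom 0 N f ≡ sumFrom 1 (N ℕ.∸ 1) f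
sumFrom-drop-zero (suc k) _ f f0≡0 = trans (cong (_+ sumFrom 1 k f) f0≡0) (ℚP.+-identityˡ _)

-- The theorem in terms of levelSum: s_b(0) = 0 removes the n = 0 term and
-- G_{b^p}(z) = (1 - z^{b^p}) / (1 - z).
digitSum-levelSum : (b p : ℕ) → .{{_ : NonZero b}} → 2 ≤ b → (z : ℚ)
  → (∀ l → l ≤ p → 1ℚ - z ^ℚ (b ^ l) ≢ 0ℚ)
  → sumFrom 1 (b ^ p ℕ.∸ 1) (λ n → ℕ→ℚ (s b n) * z ^ℚ n)
    ≡ ((1ℚ - z ^ℚ (b ^ p)) ÷' (1ℚ - z)) * levelSum b p z
digitSum-levelSum b p 2≤b z nonzero = begin
  sumFrom 1 (b ^ p ℕ.∸ 1) F
    ≡⟨ sym (sumFrom-drop-zero (b ^ p) (ℕP.m^n>0 b p) F refl) ⟩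
  digitSumGF p z
    ≡⟨ digitSumGF-closed p z nonzero ⟩
  geom (b ^ p) z * levelSum b p z
    ≡⟨ cong (_* levelSum b p z) (sym (÷'-unique _ _ (geom (b ^ p) z) 1-z≢0 (geom-closed (b ^ p) z))) ⟩
  ((1ℚ - z ^ℚ (b ^ p)) ÷' (1ℚ - z)) * levelSum b p z ∎
  where
  open ≡-Reasoning
  open GeneratingFunction b 2≤b using (digitSumGF; digitSumGF-closed)
  F : ℕ → ℚ
  F n = ℕ→ℚ (s b n) * z ^ℚ n
  1-z≢0 : 1ℚ - z ≢ 0ℚ
  1-z≢0 = subst (λ w → 1ℚ - w ≢ 0ℚ) (^ℚ-1 z) (nonzero 0 z≤n)

levelTerm-at : ∀ b z l →
  ((z ^ℚ (b ^ l) - ℕ→ℚ b * z ^ℚ (b ^ suc l)) + ℕ→ℚ (b ℕ.∸ 1) * z ^ℚ ((b ℕ.+ 1) ℕ.* b ^ l))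
    ÷' ((1ℚ - z ^ℚ (b ^ l)) * (1ℚ - z ^ℚ (b ^ suc l)))
  ≡ levelTerm b (z ^ℚ (b ^ l))
levelTerm-at b z l
  rewrite trans (cong (z ^ℚ_) (ℕP.*-comm b (b ^ l))) (^ℚ-* z (b ^ l) b)
        | trans (cong (z ^ℚ_) (ℕP.*-comm (b ℕ.+ 1) (b ^ l))) (^ℚ-* z (b ^ l) (b ℕ.+ 1)) = refl

1-w²≢0 : ∀ w → 1ℚ - w ≢ 0ℚ → 1ℚ + w ≢ 0ℚ → 1ℚ - w ^ℚ 2 ≢ 0ℚ
1-w²≢0 w 1-w≢0 1+w≢0 =
  subst (_≢ 0ℚ)
        (solve 1 (λ w → (con 1ℚ :- w) :* (con 1ℚ :+ w) := con 1ℚ :- w :* (w :* con 1ℚ)) refl w)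
        (*-≢0 _ _ 1-w≢0 1+w≢0)

binaryLevelTerm : ∀ w → 1ℚ - w ≢ 0ℚ → 1ℚ + w ≢ 0ℚ → levelTerm 2 w ≡ w ÷' (1ℚ + w)
binaryLevelTerm w 1-w≢0 1+w≢0 =
  ÷'-cross _ _ _ _ (*-≢0 _ _ 1-w≢0 (1-w²≢0 w 1-w≢0 1+w≢0)) 1+w≢0
    (solve 1 (λ w → ((w :- con (ℕ→ℚ 2) :* (w :* (w :* con 1ℚ)))
                       :+ con (ℕ→ℚ 1) :* (w :* (w :* (w :* con 1ℚ)))) :* (con 1ℚ :+ w)
                 := w :* ((con 1ℚ :- w) :* (con 1ℚ :- w :* (w :* con 1ℚ)))) refl w)

-- For b = 2, the hypotheses 1 - z ≠ 0 and 1 + z^{2^l} ≠ 0 (l < p) give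
-- 1 - z^{2^l} ≠ 0 for all l ≤ p, since 1 - z^{2^{l+1}} = (1 - z^{2^l})(1 + z^{2^l}).
binary-nonvanishing : ∀ p z → 1ℚ - z ≢ 0ℚ → (∀ l → l < p → 1ℚ + z ^ℚ (2 ^ l) ≢ 0ℚ)
                    → ∀ l → l ≤ p → 1ℚ - z ^ℚ (2 ^ l) ≢ 0ℚ
binary-nonvanishing p z 1-z≢0 _ zero _ = subst (λ w → 1ℚ - w ≢ 0ℚ) (sym (^ℚ-1 z)) 1-z≢0
binary-nonvanishing p z 1-z≢0 1+≢0 (suc l) l<p =
  subst (λ w → 1ℚ - w ≢ 0ℚ) (sym square)
        (1-w²≢0 (z ^ℚ (2 ^ l))
                (binary-nonvanishing p z 1-z≢0 1+≢0 l (ℕP.<⇒≤ l<p)) (1+≢0 l l<p))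
  where
  square : z ^ℚ (2 ^ suc l) ≡ (z ^ℚ (2 ^ l)) ^ℚ 2
  square = trans (cong (z ^ℚ_) (ℕP.*-comm 2 (2 ^ l))) (^ℚ-* z (2 ^ l) 2)

digitSumGF-base-b : (b p : ℕ) → .{{_ : NonZero b}} → 2 ≤ b → 1 ≤ p → (z : ℚ)
    → (∀ l → l ≤ p → 1ℚ - z ^ℚ (b ^ l) ≢ 0ℚ)
    → sumFrom 1 (b ^ p ℕ.∸ 1) (λ n → ℕ→ℚ (s b n) * z ^ℚ n)
      ≡ ((1ℚ - z ^ℚ (b ^ p)) ÷' (1ℚ - z))
        * sumFrom 0 p (λ l →
            ((z ^ℚ (b ^ l) - ℕ→ℚ b * z ^ℚ (b ^ suc l))
              + ℕ→ℚ (b ℕ.∸ 1) * z ^ℚ ((b ℕ.+ 1) ℕ.* b ^ l))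
            ÷' ((1ℚ - z ^ℚ (b ^ l)) * (1ℚ - z ^ℚ (b ^ suc l))))
digitSumGF-base-b b p 2≤b _ z nonzero =
  trans (digitSum-levelSum b p 2≤b z nonzero)
        (cong (((1ℚ - z ^ℚ (b ^ p)) ÷' (1ℚ - z)) *_)
              (sumFrom-cong 0 p (λ l → sym (levelTerm-at b z l))))

digitSumGF-base-2 : (p : ℕ) → 1 ≤ p → (z : ℚ)
    → 1ℚ - z ≢ 0ℚ
    → (∀ l → l < p → 1ℚ + z ^ℚ (2 ^ l) ≢ 0ℚ)
    → sumFrom 1 (2 ^ p ℕ.∸ 1) (λ n → ℕ→ℚ (s 2 n) * z ^ℚ n)
      ≡ ((1ℚ - z ^ℚ (2 ^ p)) ÷' (1ℚ - z))
        * sumFrom 0 p (λ l → z ^ℚ (2 ^ l) ÷' (1ℚ + z ^ℚ (2 ^ l)))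
digitSumGF-base-2 p _ z 1-z≢0 1+≢0 =
  trans (digitSum-levelSum 2 p (s≤s (s≤s z≤n)) z nonzero)
        (cong (((1ℚ - z ^ℚ (2 ^ p)) ÷' (1ℚ - z)) *_)
              (sumFrom-cong-on 0 p (λ l l<p →
                 binaryLevelTerm (z ^ℚ (2 ^ l)) (nonzero l (ℕP.<⇒≤ l<p)) (1+≢0 l l<p))))
  where
  nonzero : ∀ l → l ≤ p → 1ℚ - z ^ℚ (2 ^ l) ≢ 0ℚ
  nonzero = binary-nonvanishing p z 1-z≢0 1+≢0

theorem13 : ((b p : ℕ) → .{{_ : NonZero b}} → 2 ≤ b → 1 ≤ p → (z : ℚ)
    → (∀ l → l ≤ p → 1ℚ - z ^ℚ (b ^ l) ≢ 0ℚ)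
    → sumFrom 1 (b ^ p ℕ.∸ 1) (λ n → ℕ→ℚ (s b n) * z ^ℚ n)
      ≡ ((1ℚ - z ^ℚ (b ^ p)) ÷' (1ℚ - z))
        * sumFrom 0 p (λ l →
            ((z ^ℚ (b ^ l) - ℕ→ℚ b * z ^ℚ (b ^ suc l))
              + ℕ→ℚ (b ℕ.∸ 1) * z ^ℚ ((b ℕ.+ 1) ℕ.* b ^ l))
            ÷' ((1ℚ - z ^ℚ (b ^ l)) * (1ℚ - z ^ℚ (b ^ suc l)))))
  -- the b = 2 special case
    × ((p : ℕ) → 1 ≤ p → (z : ℚ)
    → 1ℚ - z ≢ 0ℚ
    → (∀ l → l < p → 1ℚ + z ^ℚ (2 ^ l) ≢ 0ℚ)
    → sumFrom 1 (2 ^ p ℕ.∸ 1) (λ n → ℕ→ℚ (s 2 n) * z ^ℚ n)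
      ≡ ((1ℚ - z ^ℚ (2 ^ p)) ÷' (1ℚ - z))
        * sumFrom 0 p (λ l → z ^ℚ (2 ^ l) ÷' (1ℚ + z ^ℚ (2 ^ l))))
theorem13 = digitSumGF-base-b , digitSumGF-base-2
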